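{- There exist $\epsilon>0$, $d$ with $10\sqrt{\epsilon}<d<1$, and $l_0$ such that the following holds. Let $G$ be a graph and let $V_1,\dots,V_r$ be pairwise disjoint subsets of $V(G)$ with $|V_i|=l\ge l_0$ for all $i$, such that $(V_i,V_{i+1})$ is $(\epsilon,d)$-super-regular for every $i\in[r-1]$. Let $x_1\in V_1$, $x_2\in V_2$. Then $G\left[\bigcup_i V_i\setminus\{x_1,x_2\}\right]$ contains a ladder $L$ whose first rung consists of a vertex of $N(x_1)\cap V_2$ and a vertex of $N(x_2)\cap V_1$, and such that $|V(L)|\ge(1-5\sqrt{\epsilon}/d)\,rl$.
   Context: For disjoint nonempty $U,V\subseteq V(G)$, $d(U,V)=e(U,V)/(|U||V|)$. The pair $(U,V)$ is $\epsilon$-regular if $|d(U',V')-d(U,V)|\le\epsilon$ for all $U'\subseteq U$, $V'\subseteq V$ with $|U'|\ge\epsilon|U|$, $|V'|\ge\epsilon|V|$. It is $(\epsilon,\delta)$-super-regular if it is $\epsilon$-regular and every $u\in U$ has $|N(u)\cap V|\ge\delta|V|$ and every $v\in V$ has $|N(v)\cap U|\ge\delta|U|$. A ladder $L_n$ is the graph on $\{a_1,\dots,a_n\}\cup\{b_1,\dots,b_n\}$ with $a_ib_j$ an edge iff $|i-j|\le 1$; the edges $a_ib_i$ are rungs and $a_1b_1$ is the first rung. -}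

module Defs where

open import Data.Bool using (Bool; true; false; if_then_else_; _∧_)
open import Data.Nat as ℕ using (ℕ; zero; suc)
open import Data.Integer using (+_)
open import Data.Fin using (Fin)
open import Data.Fin.Subset using (Subset; _∈_; _⊆_; ∣_∣)
open import Data.List using (List; map; allFin)
open import Data.Nat.ListAction using (sum)
open import Data.Vec using (lookup)
open import Data.Product using (Σ; _×_; ∃)
open import Data.Rational using (ℚ; 0ℚ; _/_; _≤_; _-_; _*_)
import Data.Rational as Q
open import Relation.Binary.PropositionalEquality using (_≡_; _≢_)
open import Relation.Nullary using (¬_)

ι : ℕ → ℚ
ι k = (+ k) / 1

record Graph (n : ℕ) : Set where
  field
    adj     : Fin n → Fin n → Bool
    sym     : ∀ u v → adj u v ≡ adj v u
    irrefl  : ∀ u → adj u u ≡ false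

open Graph public

Adj : ∀ {n} → Graph n → Fin n → Fin n → Set
Adj G u v = adj G u v ≡ true

degIn : ∀ {n} → Graph n → Fin n → Subset n → ℕ
degIn {n} G u W =
  sum (map (λ w → if lookup W w ∧ adj G u w then 1 else 0) (allFin n))

edges : ∀ {n} → Graph n → Subset n → Subset n → ℕ
edges {n} G U W =
  sum (map (λ u → if lookup U u then degIn G u W else 0) (allFin n))

-- d(U,W) = e(U,W)/(|U||W|)  (set to 0 if U or W is empty; never used then)
density : ∀ {n} → Graph n → Subset n → Subset n → ℚ
density G U W with ∣ U ∣ ℕ.* ∣ W ∣
... | zero  = 0ℚ
... | suc k = (+ edges G U W) / suc k

Regular : ∀ {n} → Graph n → ℚ → Subset n → Subset n → Set
Regular G ε U W =
  ∀ (U' W' : Subset _) → U' ⊆ U → W' ⊆ W →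
    ε * ι ∣ U ∣ ≤ ι ∣ U' ∣ → ε * ι ∣ W ∣ ≤ ι ∣ W' ∣ →
    Q.∣ density G U' W' - density G U W ∣ ≤ ε

SuperRegular : ∀ {n} → Graph n → ℚ → ℚ → Subset n → Subset n → Set
SuperRegular G ε δ U W =
  Regular G ε U W ×
  (∀ u → u ∈ U → δ * ι ∣ W ∣ ≤ ι (degIn G u W)) ×
  (∀ w → w ∈ W → δ * ι ∣ U ∣ ≤ ι (degIn G w U))

Close : ∀ {m} → Fin m → Fin m → Set
Close i j = Data.Fin.toℕ i ℕ.≤ suc (Data.Fin.toℕ j) × Data.Fin.toℕ j ℕ.≤ suc (Data.Fin.toℕ i)

-- A copy of the ladder L_m in G (as a subgraph, not necessarily induced),
-- given by the injective vertex maps i ↦ a_i, i ↦ b_i (index 0 = first rung),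
-- all of whose vertices satisfy the predicate `Allowed`.
record LadderIn {n} (G : Graph n) (Allowed : Fin n → Set) (m : ℕ) : Set where
  field
    a b     : Fin m → Fin n
    a-inj   : ∀ i j → a i ≡ a j → i ≡ j
    b-inj   : ∀ i j → b i ≡ b j → i ≡ j
    ab-dist : ∀ i j → a i ≢ b j
    edge    : ∀ i j → Close i j → Adj G (a i) (b j)
    a-ok    : ∀ i → Allowed (a i)
    b-ok    : ∀ i → Allowed (b i)

open LadderIn public

module Submission where

-- With d = 99/100 only the minimum-degree half of super-regularity is needed: every vertex misses at
-- most l/100 vertices of each neighbouring class, so the ladder can be embedded greedily, rung by rung,
-- each new vertex being a common neighbour of earlier ones.  The rungs zig-zag through the pairs
-- (V₁,V₂), (V₂,V₃), …, (V_{r-1},V_r): 2q rungs in the first pair and q in each later one, where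
-- q = 3⌊l/10⌋ + 1.  No class then holds more than 3q + 1 used vertices, which leaves room for every
-- greedy choice, while the 2rq vertices of the ladder exceed (1 - 5√ε/d) r l = 50 r l / 99 for
-- √ε = 49/500.

module Combinatorics where

  open import Data.Bool using (if_then_else_; _∧_)
  open import Data.Nat using (ℕ; zero; suc; _+_; _*_; _∸_; _≤_; _<_; z≤n; s≤s)
  open import Data.Nat.Properties
  open import Data.Nat.DivMod using (_/_; _%_; m≡m%n+[m/n]*n; m%n<n; /-monoˡ-≤)
  open import Data.Nat.Tactic.RingSolver using (solve-∀)
  open import Data.Nat.ListAction using (sum)
  open import Data.Fin using (Fin; zero; suc)
  open import Data.Fin.Subset hiding (⊤)
  open import Data.Fin.Subset.Properties
    using (∣p∣≤∣x∷p∣; p⊆q⇒∣p∣≤∣q∣; ∣⊥∣≡0; ∣p∩q∣≤∣q∣; ∣⁅x⁆∣≡1; x∈⁅x⁆; x∈⁅y⁆⇒x≡y; x∈p∩q⁻; ∩-distribˡ-∪;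
           ∩-zeroʳ; drop-there; x∉∁p⇒x∈p; x∈p∪q⁺)
  open import Data.List using (tabulate; map; allFin)
  open import Data.List.Properties using (map-tabulate; tabulate-cong)
  open import Data.Vec using (_∷_; []; lookup; here; there)
  import Data.Vec as Vec
  open import Data.Vec.Functional using () renaming (_∷_ to _◂_)
  open import Data.Vec.Properties using ([]=⇒lookup; lookup-zipWith; lookup∘tabulate)
  open import Data.Product using (Σ; ∃; _×_; _,_; proj₁; proj₂; swap)
  open import Data.Sum using (_⊎_; inj₁; inj₂)
  open import Data.Unit using (⊤; tt)
  open import Data.Empty using (⊥-elim)
  open import Function using (_∘_)
  open import Relation.Binary.PropositionalEquality using (_≡_; _≢_; refl; sym; trans; cong; cong₂; subst; module ≡-Reasoning)
  open import Defs hiding (sym)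

  ∣p∪q∣≤∣p∣+∣q∣ : ∀ {n} (p q : Subset n) → ∣ p ∪ q ∣ ≤ ∣ p ∣ + ∣ q ∣
  ∣p∪q∣≤∣p∣+∣q∣ [] [] = z≤n
  ∣p∪q∣≤∣p∣+∣q∣ (inside ∷ p) (y ∷ q) = s≤s (≤-trans (∣p∪q∣≤∣p∣+∣q∣ p q) (+-monoʳ-≤ ∣ p ∣ (∣p∣≤∣x∷p∣ y q)))
  ∣p∪q∣≤∣p∣+∣q∣ (outside ∷ p) (inside ∷ q) rewrite +-suc ∣ p ∣ ∣ q ∣ = s≤s (∣p∪q∣≤∣p∣+∣q∣ p q)
  ∣p∪q∣≤∣p∣+∣q∣ (outside ∷ p) (outside ∷ q) = ∣p∪q∣≤∣p∣+∣q∣ p q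

  ∣p∩[q∪r]∣≤∣p∩q∣+∣p∩r∣ : ∀ {n} (p q r : Subset n) → ∣ p ∩ (q ∪ r) ∣ ≤ ∣ p ∩ q ∣ + ∣ p ∩ r ∣
  ∣p∩[q∪r]∣≤∣p∩q∣+∣p∩r∣ p q r rewrite ∩-distribˡ-∪ p q r = ∣p∪q∣≤∣p∣+∣q∣ (p ∩ q) (p ∩ r)

  ∣p∣≡∣p∩q∣+∣p∩∁q∣ : ∀ {n} (p q : Subset n) → ∣ p ∣ ≡ ∣ p ∩ q ∣ + ∣ p ∩ ∁ q ∣
  ∣p∣≡∣p∩q∣+∣p∩∁q∣ [] [] = refl
  ∣p∣≡∣p∩q∣+∣p∩∁q∣ (inside ∷ p) (inside ∷ q) = cong suc (∣p∣≡∣p∩q∣+∣p∩∁q∣ p q)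
  ∣p∣≡∣p∩q∣+∣p∩∁q∣ (inside ∷ p) (outside ∷ q) = trans (cong suc (∣p∣≡∣p∩q∣+∣p∩∁q∣ p q)) (sym (+-suc _ _))
  ∣p∣≡∣p∩q∣+∣p∩∁q∣ (outside ∷ p) (y ∷ q) = ∣p∣≡∣p∩q∣+∣p∩∁q∣ p q

  ∣p∩q∣<∣p∣⇒∃∈p∉q : ∀ {n} (p q : Subset n) → ∣ p ∩ q ∣ < ∣ p ∣ → ∃ λ x → x ∈ p × x ∉ q
  ∣p∩q∣<∣p∣⇒∃∈p∉q (inside ∷ p) (outside ∷ q) _ = zero , here , λ ()
  ∣p∩q∣<∣p∣⇒∃∈p∉q (inside ∷ p) (inside ∷ q) (s≤s lt) with ∣p∩q∣<∣p∣⇒∃∈p∉q p q lt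
  ... | x , x∈p , x∉q = suc x , there x∈p , x∉q ∘ drop-there
  ∣p∩q∣<∣p∣⇒∃∈p∉q (outside ∷ p) (y ∷ q) lt with ∣p∩q∣<∣p∣⇒∃∈p∉q p q lt
  ... | x , x∈p , x∉q = suc x , there x∈p , x∉q ∘ drop-there

  ∣p∩⁅x⁆∣≤1 : ∀ {n} (p : Subset n) x → ∣ p ∩ ⁅ x ⁆ ∣ ≤ 1
  ∣p∩⁅x⁆∣≤1 p x = ≤-trans (∣p∩q∣≤∣q∣ p ⁅ x ⁆) (≤-reflexive (∣⁅x⁆∣≡1 x))

  x∉p⇒∣p∩⁅x⁆∣≡0 : ∀ {n} {x : Fin n} {p : Subset n} → x ∉ p → ∣ p ∩ ⁅ x ⁆ ∣ ≡ 0
  x∉p⇒∣p∩⁅x⁆∣≡0 {n} {x} {p} x∉p = n≤0⇒n≡0 (≤-trans (p⊆q⇒∣p∣≤∣q∣ p∩⁅x⁆⊆⊥) (≤-reflexive (∣⊥∣≡0 n)))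
    where
    p∩⁅x⁆⊆⊥ : p ∩ ⁅ x ⁆ ⊆ ⊥
    p∩⁅x⁆⊆⊥ y∈ with x∈p∩q⁻ p ⁅ x ⁆ y∈
    ... | y∈p , y∈⁅x⁆ = ⊥-elim (x∉p (subst (_∈ p) (x∈⁅y⁆⇒x≡y x y∈⁅x⁆) y∈p))

  ∣p∣≡sum-tabulate : ∀ {n} (p : Subset n) → ∣ p ∣ ≡ sum (tabulate (λ x → if lookup p x then 1 else 0))
  ∣p∣≡sum-tabulate [] = refl
  ∣p∣≡sum-tabulate (inside ∷ p) = cong suc (∣p∣≡sum-tabulate p)
  ∣p∣≡sum-tabulate (outside ∷ p) = ∣p∣≡sum-tabulate p

  pigeonhole : ∀ {n} (W X N₁ N₂ : Subset n) → ∣ W ∩ ∁ N₁ ∣ + ∣ W ∩ ∁ N₂ ∣ + ∣ W ∩ X ∣ < ∣ W ∣ →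
               ∃ λ w → w ∈ W × w ∈ N₁ × w ∈ N₂ × w ∉ X
  pigeonhole W X N₁ N₂ small with ∣p∩q∣<∣p∣⇒∃∈p∉q W (∁ N₁ ∪ ∁ N₂ ∪ X) (≤-trans (s≤s bad-bound) small)
    where
    bad-bound : ∣ W ∩ (∁ N₁ ∪ ∁ N₂ ∪ X) ∣ ≤ ∣ W ∩ ∁ N₁ ∣ + ∣ W ∩ ∁ N₂ ∣ + ∣ W ∩ X ∣
    bad-bound = ≤-trans (∣p∩[q∪r]∣≤∣p∩q∣+∣p∩r∣ W (∁ N₁) (∁ N₂ ∪ X))
      (≤-trans (+-monoʳ-≤ ∣ W ∩ ∁ N₁ ∣ (∣p∩[q∪r]∣≤∣p∩q∣+∣p∩r∣ W (∁ N₂) X))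
               (≤-reflexive (sym (+-assoc (∣ W ∩ ∁ N₁ ∣) (∣ W ∩ ∁ N₂ ∣) (∣ W ∩ X ∣)))))
  ... | w , w∈W , w∉bad = w , w∈W , x∉∁p⇒x∈p (w∉bad ∘ x∈p∪q⁺ ∘ inj₁)
                        , x∉∁p⇒x∈p (w∉bad ∘ x∈p∪q⁺ ∘ inj₂ ∘ x∈p∪q⁺ ∘ inj₁)
                        , w∉bad ∘ x∈p∪q⁺ ∘ inj₂ ∘ x∈p∪q⁺ ∘ inj₂

  Nbhd : ∀ {n} → Graph n → Fin n → Subset n
  Nbhd G u = Vec.tabulate (adj G u)

  ∈Nbhd⇒Adj : ∀ {n} (G : Graph n) {u v} → v ∈ Nbhd G u → Adj G u v
  ∈Nbhd⇒Adj G {u} {v} v∈ = trans (sym (lookup∘tabulate (adj G u) v)) ([]=⇒lookup v∈)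

  Adj-sym : ∀ {n} (G : Graph n) {u v} → Adj G u v → Adj G v u
  Adj-sym G {u} {v} uv = trans (Graph.sym G v u) uv

  degIn≡∣∩Nbhd∣ : ∀ {n} (G : Graph n) u (W : Subset n) → degIn G u W ≡ ∣ W ∩ Nbhd G u ∣
  degIn≡∣∩Nbhd∣ {n} G u W = begin
    sum (map indicator (allFin n))  ≡⟨ cong sum (map-tabulate (λ x → x) indicator) ⟩
    sum (tabulate indicator)        ≡⟨ cong sum (tabulate-cong (cong (λ b → if b then 1 else 0) ∘ sym ∘ lookup-∩)) ⟩
    sum (tabulate (λ x → if lookup (W ∩ Nbhd G u) x then 1 else 0))  ≡⟨ sym (∣p∣≡sum-tabulate (W ∩ Nbhd G u)) ⟩
    ∣ W ∩ Nbhd G u ∣                ∎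
    where
    open ≡-Reasoning
    indicator : Fin n → ℕ
    indicator x = if lookup W x ∧ adj G u x then 1 else 0
    lookup-∩ : ∀ x → lookup (W ∩ Nbhd G u) x ≡ (lookup W x ∧ adj G u x)
    lookup-∩ x = trans (lookup-zipWith _∧_ x W (Nbhd G u)) (cong (lookup W x ∧_) (lookup∘tabulate (adj G u) x))

  -- L could be preceded by the rung (x, y), save for the edge xy itself.
  Hooked : ∀ {n} {G : Graph n} {P : Fin n → Set} {m} → LadderIn G P m → Fin n → Fin n → Set
  Hooked {m = zero} L x y = ⊤
  Hooked {G = G} {m = suc m} L x y = Adj G x (b L zero) × Adj G (a L zero) y

  module _ {n} {G : Graph n} where

    emptyLadder : ∀ {P} → LadderIn G P 0
    emptyLadder = record
      { a = λ () ; b = λ () ; a-inj = λ () ; b-inj = λ () ; ab-dist = λ ()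
      ; edge = λ () ; a-ok = λ () ; b-ok = λ () }

    LadderIn-map : ∀ {P Q m} → (∀ {x} → P x → Q x) → LadderIn G P m → LadderIn G Q m
    LadderIn-map P⇒Q L = record
      { a = a L ; b = b L ; a-inj = a-inj L ; b-inj = b-inj L ; ab-dist = ab-dist L
      ; edge = edge L ; a-ok = P⇒Q ∘ a-ok L ; b-ok = P⇒Q ∘ b-ok L }

    swapLadder : ∀ {P m} → LadderIn G P m → LadderIn G P m
    swapLadder L = record
      { a = b L ; b = a L ; a-inj = b-inj L ; b-inj = a-inj L
      ; ab-dist = λ i j e → ab-dist L j i (sym e)
      ; edge = λ i j c → Adj-sym G (edge L j i (swap c))
      ; a-ok = b-ok L ; b-ok = a-ok L }

    Hooked-swap : ∀ {P m} (L : LadderIn G P m) {x y} → Hooked L x y → Hooked (swapLadder L) y x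
    Hooked-swap {m = zero} L _ = tt
    Hooked-swap {m = suc m} L (x~b₀ , a₀~y) = Adj-sym G a₀~y , Adj-sym G x~b₀

    prepend : ∀ {P Q m} {v w : Fin n} (L : LadderIn G Q m) →
              Adj G v w → Hooked L v w → P v → P w → v ≢ w →
              (∀ {x} → Q x → P x × x ≢ v × x ≢ w) → LadderIn G P (suc m)
    prepend {v = v} {w} L v~w hooked Pv Pw v≢w Q⇒P = record
      { a = v ◂ a L ; b = w ◂ b L
      ; a-inj = a-inj′ ; b-inj = b-inj′ ; ab-dist = ab-dist′ ; edge = edge′
      ; a-ok = λ { zero → Pv ; (suc i) → proj₁ (Q⇒P (a-ok L i)) }
      ; b-ok = λ { zero → Pw ; (suc i) → proj₁ (Q⇒P (b-ok L i)) } }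
      where
      a-inj′ : ∀ i j → (v ◂ a L) i ≡ (v ◂ a L) j → i ≡ j
      a-inj′ zero zero _ = refl
      a-inj′ zero (suc j) e = ⊥-elim (proj₁ (proj₂ (Q⇒P (a-ok L j))) (sym e))
      a-inj′ (suc i) zero e = ⊥-elim (proj₁ (proj₂ (Q⇒P (a-ok L i))) e)
      a-inj′ (suc i) (suc j) e = cong suc (a-inj L i j e)
      b-inj′ : ∀ i j → (w ◂ b L) i ≡ (w ◂ b L) j → i ≡ j
      b-inj′ zero zero _ = refl
      b-inj′ zero (suc j) e = ⊥-elim (proj₂ (proj₂ (Q⇒P (b-ok L j))) (sym e))
      b-inj′ (suc i) zero e = ⊥-elim (proj₂ (proj₂ (Q⇒P (b-ok L i))) e)
      b-inj′ (suc i) (suc j) e = cong suc (b-inj L i j e)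
      ab-dist′ : ∀ i j → (v ◂ a L) i ≢ (w ◂ b L) j
      ab-dist′ zero zero = v≢w
      ab-dist′ zero (suc j) e = proj₁ (proj₂ (Q⇒P (b-ok L j))) (sym e)
      ab-dist′ (suc i) zero = proj₂ (proj₂ (Q⇒P (a-ok L i)))
      ab-dist′ (suc i) (suc j) = ab-dist L i j
      edge′ : ∀ i j → Close i j → Adj G ((v ◂ a L) i) ((w ◂ b L) j)
      edge′ zero zero _ = v~w
      edge′ zero (suc zero) _ = proj₁ hooked
      edge′ zero (suc (suc j)) (_ , s≤s ())
      edge′ (suc zero) zero _ = proj₂ hooked
      edge′ (suc (suc i)) zero (s≤s () , _)
      edge′ (suc i) (suc j) (s≤s i≤j+1 , s≤s j≤i+1) = edge L i j (i≤j+1 , j≤i+1)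

  module Classes (r : ℕ) where

    InRange : ℕ → Set
    InRange c = 1 ≤ c × c ≤ r

    infix 4 _~_
    _~_ : ℕ → ℕ → Set
    c ~ c' = InRange c × InRange c' × (suc c ≡ c' ⊎ suc c' ≡ c)

    ~-sym : ∀ {c c'} → c ~ c' → c' ~ c
    ~-sym (rc , rc' , inj₁ e) = rc' , rc , inj₂ e
    ~-sym (rc , rc' , inj₂ e) = rc' , rc , inj₁ e

    ~⇒≢ : ∀ {c c'} → c ~ c' → c ≢ c'
    ~⇒≢ (_ , _ , inj₁ e) refl = 1+n≢n e
    ~⇒≢ (_ , _ , inj₂ e) refl = 1+n≢n e

  module Greedy {n} (G : Graph n) (V : ℕ → Subset n) (r l : ℕ) where

    open Classes r public

    InClasses : Fin n → Set
    InClasses v = ∃ λ i → 1 ≤ i × i ≤ r × v ∈ V i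

    Fresh : Subset n → Fin n → Set
    Fresh U v = InClasses v × v ∉ U

    load : Subset n → ℕ → ℕ
    load U c = ∣ V c ∩ U ∣

    load-⊥ : ∀ c → load ⊥ c ≡ 0
    load-⊥ c = trans (cong ∣_∣ (∩-zeroʳ (V c))) (∣⊥∣≡0 n)

    withRung : Subset n → Fin n → Fin n → Subset n
    withRung U v w = U ∪ (⁅ v ⁆ ∪ ⁅ w ⁆)

    ∉-withRung : ∀ {U v w z} → z ∉ withRung U v w → z ∉ U × z ≢ v × z ≢ w
    ∉-withRung {U} {v} {w} z∉ =
        z∉ ∘ x∈p∪q⁺ ∘ inj₁
      , (λ { refl → z∉ (x∈p∪q⁺ (inj₂ (x∈p∪q⁺ (inj₁ (x∈⁅x⁆ v))))) })
      , (λ { refl → z∉ (x∈p∪q⁺ (inj₂ (x∈p∪q⁺ (inj₂ (x∈⁅x⁆ w))))) })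

    load-withRung : ∀ U v w c → load (withRung U v w) c ≤ load U c + (∣ V c ∩ ⁅ v ⁆ ∣ + ∣ V c ∩ ⁅ w ⁆ ∣)
    load-withRung U v w c = ≤-trans (∣p∩[q∪r]∣≤∣p∩q∣+∣p∩r∣ (V c) U (⁅ v ⁆ ∪ ⁅ w ⁆))
      (+-monoʳ-≤ (load U c) (∣p∩[q∪r]∣≤∣p∩q∣+∣p∩r∣ (V c) ⁅ v ⁆ ⁅ w ⁆))

    -- The ladder is grown at its first rung, so what is still to be built after the last placed rung
    -- (x, y) is a ladder hooked to (x, y) and avoiding the set U of vertices used so far.
    Extension : ℕ → Fin n → Fin n → Subset n → Set
    Extension k x y U = Σ (LadderIn G (Fresh U) k) λ L → Hooked L x y

    swapExtension : ∀ {k x y U} → Extension k x y U → Extension k y x U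
    swapExtension (L , hooked) = swapLadder L , Hooked-swap L hooked

    FirstRungIn : ∀ {P m} → LadderIn G P (suc m) → ℕ → ℕ → Set
    FirstRungIn L A B = a L zero ∈ V A × b L zero ∈ V B

    record Growth (A B j : ℕ) (U U' : Subset n) : Set where
      field
        growthA : load U' A ≤ load U A + j
        growthB : load U' B ≤ load U B + j
        others  : ∀ {c} → InRange c → c ≢ A → c ≢ B → load U' c ≤ load U c

    open Growth

    Growth-step : ∀ {A B j U U₁ U₂} → Growth A B 1 U U₁ → Growth A B j U₁ U₂ → Growth A B (suc j) U U₂
    Growth-step {A} {B} {j} {U} g₁ g₂ = record
      { growthA = ≤-trans (growthA g₂) (≤-trans (+-monoˡ-≤ j (growthA g₁)) (≤-reflexive (+-assoc (load U A) 1 j)))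
      ; growthB = ≤-trans (growthB g₂) (≤-trans (+-monoˡ-≤ j (growthB g₁)) (≤-reflexive (+-assoc (load U B) 1 j)))
      ; others = λ rc c≢A c≢B → ≤-trans (others g₂ rc c≢A c≢B) (others g₁ rc c≢A c≢B) }

    record NextRung (A B : ℕ) (x y : Fin n) (U : Subset n) : Set where
      field
        v w : Fin n
        v∈A : v ∈ V A
        w∈B : w ∈ V B
        v∉U : v ∉ U
        w∉U : w ∉ U
        v~w : Adj G v w
        v~y : Adj G v y
        x~w : Adj G x w

    open NextRung

    module Embedding
      (disjoint : ∀ {i j v} → InRange i → InRange j → i ≢ j → v ∈ V i → v ∉ V j)
      (size : ∀ {c} → InRange c → ∣ V c ∣ ≡ l)
      (fewNonNeighbours : ∀ {c c' u} → c ~ c' → u ∈ V c' → 100 * ∣ V c ∩ ∁ (Nbhd G u) ∣ ≤ ∣ V c ∣)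
      where

      ∣∩⁅x⁆∣≡0 : ∀ {c C x} → InRange c → InRange C → c ≢ C → x ∈ V C → ∣ V c ∩ ⁅ x ⁆ ∣ ≡ 0
      ∣∩⁅x⁆∣≡0 rc rC c≢C x∈C = x∉p⇒∣p∩⁅x⁆∣≡0 (disjoint rC rc (c≢C ∘ sym) x∈C)

      growth-rung : ∀ {A B U v w} → B ~ A → v ∈ V A → w ∈ V B → Growth A B 1 U (withRung U v w)
      growth-rung {A} {B} {U} {v} {w} B~A@(rB , rA , _) v∈A w∈B = record
        { growthA = ≤-trans (load-withRung U v w A)
            (+-monoʳ-≤ (load U A) (+-mono-≤ (∣p∩⁅x⁆∣≤1 (V A) v) (≤-reflexive (∣∩⁅x⁆∣≡0 rA rB A≢B w∈B))))
        ; growthB = ≤-trans (load-withRung U v w B)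
            (+-monoʳ-≤ (load U B) (+-mono-≤ (≤-reflexive (∣∩⁅x⁆∣≡0 rB rA (A≢B ∘ sym) v∈A)) (∣p∩⁅x⁆∣≤1 (V B) w)))
        ; others = λ {c} rc c≢A c≢B → ≤-trans (load-withRung U v w c) (≤-reflexive (trans
            (cong₂ (λ s t → load U c + (s + t)) (∣∩⁅x⁆∣≡0 rc rA c≢A v∈A) (∣∩⁅x⁆∣≡0 rc rB c≢B w∈B))
            (+-identityʳ (load U c)))) }
        where
        A≢B : A ≢ B
        A≢B = ~⇒≢ (~-sym B~A)

      extend : ∀ {A B x y U k} → B ~ A → (R : NextRung A B x y U) →
               Extension k (v R) (w R) (withRung U (v R) (w R)) → Extension (suc k) x y U
      extend B~A@(rB , rA , _) R (L , hooked) =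
          prepend L (v~w R) hooked ((_ , proj₁ rA , proj₂ rA , v∈A R) , v∉U R) ((_ , proj₁ rB , proj₂ rB , w∈B R) , w∉U R)
            (λ v≡w → disjoint rA rB (~⇒≢ (~-sym B~A)) (v∈A R) (subst (_∈ V _) (sym v≡w) (w∈B R)))
            (λ { (inClasses , z∉) → let z∉U , z≢v , z≢w = ∉-withRung z∉ in (inClasses , z∉U) , z≢v , z≢w })
        , x~w R , v~y R

      module _ (cap : ℕ) (roomy : 50 * cap < 49 * l) where

        room : ∀ a b u → 100 * a ≤ l → 100 * b ≤ l → u ≤ cap → a + b + u < l
        room a b u a≤ b≤ u≤cap = *-cancelˡ-< 100 (a + b + u) l (begin-strict
          100 * (a + b + u)                ≡⟨ spread a b u ⟩
          100 * a + 100 * b + 2 * (50 * u) ≤⟨ +-mono-≤ (+-mono-≤ a≤ b≤) (*-monoʳ-≤ 2 (*-monoʳ-≤ 50 u≤cap)) ⟩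
          l + l + 2 * (50 * cap)           <⟨ +-monoʳ-< (l + l) (*-monoʳ-< 2 roomy) ⟩
          l + l + 2 * (49 * l)             ≡⟨ gather l ⟩
          100 * l                          ∎)
          where
          open ≤-Reasoning
          spread : ∀ a b u → 100 * (a + b + u) ≡ 100 * a + 100 * b + 2 * (50 * u)
          spread = solve-∀
          gather : ∀ l → l + l + 2 * (49 * l) ≡ 100 * l
          gather = solve-∀

        commonNeighbour : ∀ {c c₁ c₂ u₁ u₂ X} → c ~ c₁ → c ~ c₂ → u₁ ∈ V c₁ → u₂ ∈ V c₂ → load X c ≤ cap →
                          ∃ λ w → w ∈ V c × Adj G u₁ w × Adj G u₂ w × w ∉ X
        commonNeighbour {c} {u₁ = u₁} {u₂} {X} c~c₁@(rc , _) c~c₂ u₁∈ u₂∈ X-room =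
          adjacent (pigeonhole (V c) X (Nbhd G u₁) (Nbhd G u₂) (subst (_ <_) (sym (size rc)) (room
            ∣ V c ∩ ∁ (Nbhd G u₁) ∣ ∣ V c ∩ ∁ (Nbhd G u₂) ∣ (load X c)
            (≤-trans (fewNonNeighbours c~c₁ u₁∈) (≤-reflexive (size rc)))
            (≤-trans (fewNonNeighbours c~c₂ u₂∈) (≤-reflexive (size rc))) X-room)))
          where
          adjacent : (∃ λ w → w ∈ V c × w ∈ Nbhd G u₁ × w ∈ Nbhd G u₂ × w ∉ X) →
                     ∃ λ w → w ∈ V c × Adj G u₁ w × Adj G u₂ w × w ∉ X
          adjacent (w , w∈ , w∈N₁ , w∈N₂ , w∉X) = w , w∈ , ∈Nbhd⇒Adj G w∈N₁ , ∈Nbhd⇒Adj G w∈N₂ , w∉X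

        pickRung : ∀ {A B A₀ B₀ x y U} → A ~ B₀ → B ~ A₀ → B ~ A → x ∈ V A₀ → y ∈ V B₀ →
                   load U A ≤ cap → load U B ≤ cap → NextRung A B x y U
        pickRung {A} {B} {x = x} {y} {U} A~B₀ B~A₀ B~A x∈ y∈ roomA roomB =
          second (commonNeighbour A~B₀ A~B₀ y∈ y∈ roomA)
          where
          second : (∃ λ v → v ∈ V A × Adj G y v × Adj G y v × v ∉ U) → NextRung A B x y U
          second (v , v∈A , y~v , _ , v∉U) = finish (commonNeighbour B~A₀ B~A x∈ v∈A roomB)
            where
            finish : (∃ λ w → w ∈ V B × Adj G x w × Adj G v w × w ∉ U) → NextRung A B x y U
            finish (w , w∈B , x~w , v~w , w∉U) = record
              { v = v ; w = w ; v∈A = v∈A ; w∈B = w∈B ; v∉U = v∉U ; w∉U = w∉U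
              ; v~w = v~w ; v~y = Adj-sym G y~v ; x~w = x~w }

        -- Places suc j rungs with a ∈ V A and b ∈ V B in front of whatever the continuation builds
        -- from the last of them.
        runBlock : ∀ j {A B A₀ B₀ x y U k} → A ~ B₀ → B ~ A₀ → B ~ A → x ∈ V A₀ → y ∈ V B₀ →
          load U A + j ≤ cap → load U B + j ≤ cap →
          (∀ {x' y' U'} → x' ∈ V A → y' ∈ V B → Growth A B (suc j) U U' → Extension k x' y' U') →
          Σ (Extension (suc j + k) x y U) λ E → FirstRungIn (proj₁ E) A B
        runBlock zero A~B₀ B~A₀ B~A x∈ y∈ roomA roomB continue =
            extend B~A R (continue (v∈A R) (w∈B R) (growth-rung B~A (v∈A R) (w∈B R)))
          , v∈A R , w∈B R
          where
          R = pickRung A~B₀ B~A₀ B~A x∈ y∈ (≤-trans (m≤m+n _ 0) roomA) (≤-trans (m≤m+n _ 0) roomB)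
        runBlock (suc j) {U = U} A~B₀ B~A₀ B~A x∈ y∈ roomA roomB continue =
            extend B~A R (proj₁ (runBlock j (~-sym B~A) B~A B~A (v∈A R) (w∈B R)
                                   (shift (growthA g) roomA) (shift (growthB g) roomB)
                                   (λ x'∈ y'∈ g' → continue x'∈ y'∈ (Growth-step g g'))))
          , v∈A R , w∈B R
          where
          R = pickRung A~B₀ B~A₀ B~A x∈ y∈ (≤-trans (m≤m+n _ (suc j)) roomA) (≤-trans (m≤m+n _ (suc j)) roomB)
          g = growth-rung {U = U} B~A (v∈A R) (w∈B R)
          shift : ∀ {u₁ u} → u₁ ≤ u + 1 → u + suc j ≤ cap → u₁ + j ≤ cap
          shift {u₁} {u} u₁≤ room = ≤-trans (+-monoˡ-≤ j u₁≤) (≤-trans (≤-reflexive (+-assoc u 1 j)) room)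

      module Blocks (j : ℕ) (roomy : 50 * (3 * suc j) < 49 * l) where

        q : ℕ
        q = suc j

        -- The state after the blocks in (V₁,V₂), …, (V_{β+1},V_{β+2}), oriented so that the class
        -- V_{β+2} shared with the next block holds the a-vertex x of the last rung.
        record Frontier (β : ℕ) : Set where
          field
            x y : Fin n
            U : Subset n
            x∈ : x ∈ V (2 + β)
            y∈ : y ∈ V (1 + β)
            oldLoad : load U (2 + β) ≤ 1 + 2 * q
            unused : ∀ {c} → InRange c → 2 + β < c → load U c ≡ 0

        open Frontier

        fromFrontier : ∀ t {β} → 2 + β + t ≡ r → (F : Frontier β) → Extension (t * q) (x F) (y F) (U F)
        fromFrontier zero _ F = emptyLadder , tt
        fromFrontier (suc t) {β} 2+β+t≡r F =
          proj₁ (runBlock (3 * q) roomy j A~B₀ B~A B~A (x∈ F) (y∈ F) roomOld roomNew next)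
          where
          3+β≤r : 3 + β ≤ r
          3+β≤r = ≤-trans (s≤s (s≤s (≤-trans (m≤m+n (suc β) t) (≤-reflexive (sym (+-suc β t)))))) (≤-reflexive 2+β+t≡r)
          r₁ : InRange (1 + β)
          r₁ = s≤s z≤n , ≤-trans (n≤1+n _) (≤-trans (n≤1+n _) 3+β≤r)
          r₂ : InRange (2 + β)
          r₂ = s≤s z≤n , ≤-trans (n≤1+n _) 3+β≤r
          r₃ : InRange (3 + β)
          r₃ = s≤s z≤n , 3+β≤r
          A~B₀ : 2 + β ~ 1 + β
          A~B₀ = r₂ , r₁ , inj₂ refl
          B~A : 3 + β ~ 2 + β
          B~A = r₃ , r₂ , inj₂ refl
          roomOld : load (U F) (2 + β) + j ≤ 3 * q
          roomOld = ≤-trans (+-monoˡ-≤ j (oldLoad F)) (≤-reflexive (three-blocks j))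
            where
            three-blocks : ∀ j → 1 + 2 * suc j + j ≡ 3 * suc j
            three-blocks = solve-∀
          roomNew : load (U F) (3 + β) + j ≤ 3 * q
          roomNew rewrite unused F r₃ ≤-refl = ≤-trans (n≤1+n j) (m≤m+n q (2 * q))
          next : ∀ {x' y' U'} → x' ∈ V (2 + β) → y' ∈ V (3 + β) → Growth (2 + β) (3 + β) q (U F) U' →
                 Extension (t * q) x' y' U'
          next {x'} {y'} {U'} x'∈ y'∈ g =
            swapExtension (fromFrontier t (trans (cong (2 +_) (sym (+-suc β t))) 2+β+t≡r) (record
              { x = y' ; y = x' ; U = U' ; x∈ = y'∈ ; y∈ = x'∈
              ; oldLoad = ≤-trans (growthB g) (≤-trans (≤-reflexive (cong (_+ q) (unused F r₃ ≤-refl)))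
                                                      (≤-trans (m≤m+n q (q + 0)) (n≤1+n _)))
              ; unused = λ rc 3+β<c → n≤0⇒n≡0 (≤-trans (others g rc (>⇒≢ (≤-trans (n≤1+n _) 3+β<c)) (>⇒≢ 3+β<c))
                                                       (≤-reflexive (unused F rc (≤-trans (n≤1+n _) 3+β<c)))) }))

        ladder : ∀ {x₁ x₂} → 2 ≤ r → x₁ ∈ V 1 → x₂ ∈ V 2 →
          Σ (Extension (suc (j + q + (r ∸ 2) * q)) x₂ x₁ (withRung ⊥ x₂ x₁)) λ E → FirstRungIn (proj₁ E) 2 1
        ladder {x₁} {x₂} 2≤r x₁∈ x₂∈ =
          runBlock (3 * q) roomy (j + q) 2~1 1~2 1~2 x₂∈ x₁∈ (room-start 2 (inj₁ refl)) (room-start 1 (inj₂ refl)) first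
          where
          U₀ : Subset n
          U₀ = withRung ⊥ x₂ x₁
          1~2 : 1 ~ 2
          1~2 = (s≤s z≤n , ≤-trans (n≤1+n 1) 2≤r) , (s≤s z≤n , 2≤r) , inj₁ refl
          2~1 : 2 ~ 1
          2~1 = ~-sym 1~2
          g₀ : Growth 2 1 1 ⊥ U₀
          g₀ = growth-rung 1~2 x₂∈ x₁∈
          load₀ : ∀ c → c ≡ 2 ⊎ c ≡ 1 → load U₀ c ≤ 1
          load₀ c (inj₁ refl) = ≤-trans (growthA g₀) (≤-reflexive (cong (_+ 1) (load-⊥ 2)))
          load₀ c (inj₂ refl) = ≤-trans (growthB g₀) (≤-reflexive (cong (_+ 1) (load-⊥ 1)))
          room-start : ∀ c → c ≡ 2 ⊎ c ≡ 1 → load U₀ c + (j + q) ≤ 3 * q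
          room-start c c∈ = ≤-trans (+-monoˡ-≤ (j + q) (load₀ c c∈)) (≤-trans (m≤m+n _ q) (≤-reflexive (three-blocks j)))
            where
            three-blocks : ∀ j → 1 + (j + suc j) + suc j ≡ 3 * suc j
            three-blocks = solve-∀
          first : ∀ {x' y' U'} → x' ∈ V 2 → y' ∈ V 1 → Growth 2 1 (suc (j + q)) U₀ U' →
                  Extension ((r ∸ 2) * q) x' y' U'
          first {x'} {y'} {U'} x'∈ y'∈ g = fromFrontier (r ∸ 2) (m+[n∸m]≡n 2≤r) (record
            { x = x' ; y = y' ; U = U' ; x∈ = x'∈ ; y∈ = y'∈
            ; oldLoad = ≤-trans (growthA g) (≤-trans (+-monoˡ-≤ _ (load₀ 2 (inj₁ refl))) (≤-reflexive (cong suc (two-blocks j))))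
            ; unused = λ {c} rc 2<c → n≤0⇒n≡0 (≤-trans (others g rc (>⇒≢ 2<c) (>⇒≢ (≤-trans (n≤1+n 2) 2<c)))
                         (≤-trans (others g₀ rc (>⇒≢ 2<c) (>⇒≢ (≤-trans (n≤1+n 2) 2<c))) (≤-reflexive (load-⊥ c)))) })
            where
            two-blocks : ∀ j → suc (j + suc j) ≡ 2 * suc j
            two-blocks = solve-∀

  blockSize : ℕ → ℕ
  blockSize l = 3 * (l / 10)

  blockSize-room : ∀ {l} → 50 ≤ l → 50 * (3 * suc (blockSize l)) < 49 * l
  blockSize-room {l} 50≤l = subst (λ k → 50 * (3 * suc (blockSize l)) < 49 * k) (sym (m≡m%n+[m/n]*n l 10))
    (digits (l / 10) (l % 10) (/-monoˡ-≤ 10 50≤l))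
    where
    digits : ∀ h ρ → 5 ≤ h → 50 * (3 * suc (3 * h)) < 49 * (ρ + h * 10)
    digits h ρ 5≤h = begin-strict
      50 * (3 * suc (3 * h))  ≡⟨ expand h ⟩
      150 + 450 * h           <⟨ +-monoˡ-< (450 * h) (≤-trans (m≤m+n 151 49) (*-monoʳ-≤ 40 5≤h)) ⟩
      40 * h + 450 * h        ≡⟨ collect h ⟩
      49 * (h * 10)           ≤⟨ *-monoʳ-≤ 49 (m≤n+m (h * 10) ρ) ⟩
      49 * (ρ + h * 10)       ∎
      where
      open ≤-Reasoning
      expand : ∀ h → 50 * (3 * suc (3 * h)) ≡ 150 + 450 * h
      expand = solve-∀
      collect : ∀ h → 40 * h + 450 * h ≡ 49 * (h * 10)
      collect = solve-∀

  blockSize-long : ∀ {l} → 50 ≤ l → 50 * l ≤ 198 * suc (blockSize l)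
  blockSize-long {l} 50≤l = subst (λ k → 50 * k ≤ 198 * suc (blockSize l)) (sym (m≡m%n+[m/n]*n l 10))
    (digits (l / 10) (l % 10) (/-monoˡ-≤ 10 50≤l) (≤-pred (m%n<n l 10)))
    where
    digits : ∀ h ρ → 5 ≤ h → ρ ≤ 9 → 50 * (ρ + h * 10) ≤ 198 * suc (3 * h)
    digits h ρ 5≤h ρ≤9 = begin
      50 * (ρ + h * 10)       ≤⟨ *-monoʳ-≤ 50 (+-monoˡ-≤ (h * 10) ρ≤9) ⟩
      50 * (9 + h * 10)       ≡⟨ expand h ⟩
      450 + 500 * h           ≤⟨ +-monoˡ-≤ (500 * h) (≤-trans (m≤m+n 450 218) (+-monoʳ-≤ 198 (*-monoʳ-≤ 94 5≤h))) ⟩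
      198 + 94 * h + 500 * h  ≡⟨ collect h ⟩
      198 * suc (3 * h)       ∎
      where
      open ≤-Reasoning
      expand : ∀ h → 50 * (9 + h * 10) ≡ 450 + 500 * h
      expand = solve-∀
      collect : ∀ h → 198 + 94 * h + 500 * h ≡ 198 * suc (3 * h)
      collect = solve-∀

  ladder-long : ∀ {r l} j → 2 ≤ r → 50 * l ≤ 198 * suc j →
                50 * (r * l) ≤ 99 * (2 * suc (j + suc j + (r ∸ 2) * suc j))
  ladder-long {r} {l} j 2≤r long =
    subst (λ k → 50 * (k * l) ≤ 99 * (2 * suc (j + suc j + (r ∸ 2) * suc j))) (m+[n∸m]≡n 2≤r) (blocks (r ∸ 2))
    where
    blocks : ∀ t → 50 * ((2 + t) * l) ≤ 99 * (2 * suc (j + suc j + t * suc j))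
    blocks t = begin
      50 * ((2 + t) * l)                      ≡⟨ regroup t l ⟩
      (2 + t) * (50 * l)                      ≤⟨ *-monoʳ-≤ (2 + t) long ⟩
      (2 + t) * (198 * suc j)                 ≡⟨ count-rungs t j ⟩
      99 * (2 * suc (j + suc j + t * suc j))  ∎
      where
      open ≤-Reasoning
      regroup : ∀ t l → 50 * ((2 + t) * l) ≡ (2 + t) * (50 * l)
      regroup = solve-∀
      count-rungs : ∀ t j → (2 + t) * (198 * suc j) ≡ 99 * (2 * suc (j + suc j + t * suc j))
      count-rungs = solve-∀

module Densities where

  open import Data.Nat as ℕ using (ℕ; suc)
  import Data.Nat.Properties as ℕ
  open import Data.Nat.Tactic.RingSolver using (solve-∀)
  open import Data.Integer as ℤ using (+_; +≤+)
  import Data.Integer.Properties as ℤ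
  open import Data.Nat.Coprimality using (1-coprimeTo) renaming (sym to coprime-sym)
  open import Data.Fin.Subset using (Subset; _∈_; _∩_; ∁; ∣_∣)
  open import Data.Product using (_,_; proj₁; proj₂)
  open import Data.Sum using (inj₁; inj₂)
  open import Data.Rational using (ℚ; _≤_; _-_; _*_; _/_; toℚᵘ)
  open import Data.Rational.Properties using (normalize-coprime; toℚᵘ-homo-*; toℚᵘ-mono-≤; toℚᵘ-cancel-≤)
  open import Data.Rational.Unnormalised using (mkℚᵘ; *≤*) renaming (_≤_ to _≤ᵘ_; _≃_ to _≃ᵘ_; _*_ to _*ᵘ_)
  open import Data.Rational.Unnormalised.Properties using (≃-sym; ≃-trans; ≃-reflexive; ≤-respˡ-≃; ≤-respʳ-≃)
  open import Relation.Binary.PropositionalEquality using (_≡_; refl; sym; trans; cong; subst; subst₂)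
  open import Defs hiding (sym)
  open Combinatorics using (Nbhd; degIn≡∣∩Nbhd∣; ∣p∣≡∣p∩q∣+∣p∩∁q∣; module Classes)

  √ε d : ℚ
  √ε = + 49 / 500
  d = + 99 / 100

  toℚᵘ-ι : ∀ k → toℚᵘ (ι k) ≡ mkℚᵘ (+ k) 0
  toℚᵘ-ι k = cong toℚᵘ (normalize-coprime (coprime-sym (1-coprimeTo k)))

  toℚᵘ-*ι : ∀ p k → toℚᵘ (p * ι k) ≃ᵘ toℚᵘ p *ᵘ mkℚᵘ (+ k) 0
  toℚᵘ-*ι p k = ≃-trans (toℚᵘ-homo-* p (ι k)) (≃-reflexive (cong (toℚᵘ p *ᵘ_) (toℚᵘ-ι k)))

  degree-bound : ∀ l g → d * ι l ≤ ι g → 99 ℕ.* l ℕ.≤ 100 ℕ.* g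
  degree-bound l g dl≤g with subst (_ ≤ᵘ_) (toℚᵘ-ι g) (≤-respˡ-≃ (toℚᵘ-*ι d l) (toℚᵘ-mono-≤ dl≤g))
  ... | *≤* cross = ℕ.≤-trans (ℤ.drop‿+≤+ (subst₂ ℤ._≤_ lhs (sym (ℤ.pos-* g 100)) cross)) (ℕ.≤-reflexive (ℕ.*-comm g 100))
    where
    lhs : (+ 99 ℤ.* + l) ℤ.* + 1 ≡ + (99 ℕ.* l)
    lhs = trans (ℤ.*-identityʳ _) (sym (ℤ.pos-* 99 l))

  half-≤ : ∀ X Y → 50 ℕ.* X ℕ.≤ 99 ℕ.* Y → (d - ι 5 * √ε) * ι X ≤ d * ι Y
  half-≤ X Y le = toℚᵘ-cancel-≤ (≤-respʳ-≃ (≃-sym (toℚᵘ-*ι d Y)) (≤-respˡ-≃ (≃-sym (toℚᵘ-*ι (d - ι 5 * √ε) X)) (*≤* cross)))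
    where
    rearrange : ∀ x → 50 ℕ.* x ℕ.* 2 ≡ x ℕ.* 100
    rearrange = solve-∀
    lhs : + (50 ℕ.* X ℕ.* 2) ≡ (+ 1 ℤ.* + X) ℤ.* + 100
    lhs = trans (cong +_ (rearrange X)) (trans (ℤ.pos-* X 100) (cong (ℤ._* + 100) (sym (ℤ.*-identityˡ (+ X)))))
    rhs : + (99 ℕ.* Y ℕ.* 2) ≡ (+ 99 ℤ.* + Y) ℤ.* + 2
    rhs = trans (ℤ.pos-* (99 ℕ.* Y) 2) (cong (ℤ._* + 2) (ℤ.pos-* 99 Y))
    cross : (+ 1 ℤ.* + X) ℤ.* + 100 ℤ.≤ (+ 99 ℤ.* + Y) ℤ.* + 2
    cross = subst₂ ℤ._≤_ lhs rhs (+≤+ (ℕ.*-monoˡ-≤ 2 le))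

  nonNeighbours-few : ∀ {n} (G : Graph n) (W : Subset n) u → d * ι ∣ W ∣ ≤ ι (degIn G u W) →
                      100 ℕ.* ∣ W ∩ ∁ (Nbhd G u) ∣ ℕ.≤ ∣ W ∣
  nonNeighbours-few G W u dense = ℕ.+-cancelʳ-≤ (99 ℕ.* ∣ W ∣) (100 ℕ.* non) ∣ W ∣ (begin
      100 ℕ.* non ℕ.+ 99 ℕ.* ∣ W ∣  ≤⟨ ℕ.+-monoʳ-≤ (100 ℕ.* non) many-neighbours ⟩
      100 ℕ.* non ℕ.+ 100 ℕ.* deg   ≡⟨ ℕ.*-distribˡ-+ 100 non deg ⟨
      100 ℕ.* (non ℕ.+ deg)         ≡⟨ cong (100 ℕ.*_) (trans (ℕ.+-comm non deg) (sym (∣p∣≡∣p∩q∣+∣p∩∁q∣ W (Nbhd G u)))) ⟩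
      100 ℕ.* ∣ W ∣                 ∎)
    where
    open ℕ.≤-Reasoning
    deg = ∣ W ∩ Nbhd G u ∣
    non = ∣ W ∩ ∁ (Nbhd G u) ∣
    many-neighbours : 99 ℕ.* ∣ W ∣ ℕ.≤ 100 ℕ.* deg
    many-neighbours = subst (λ k → 99 ℕ.* ∣ W ∣ ℕ.≤ 100 ℕ.* k) (degIn≡∣∩Nbhd∣ G u W) (degree-bound ∣ W ∣ (degIn G u W) dense)

  superRegular⇒fewNonNeighbours : ∀ {n} (G : Graph n) (V : ℕ → Subset n) r {ε} →
    (∀ i → 1 ℕ.≤ i → suc i ℕ.≤ r → SuperRegular G ε d (V i) (V (suc i))) →
    ∀ {c c' u} → Classes._~_ r c c' → u ∈ V c' → 100 ℕ.* ∣ V c ∩ ∁ (Nbhd G u) ∣ ℕ.≤ ∣ V c ∣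
  superRegular⇒fewNonNeighbours G V r superRegular {c} ((c≥1 , _) , (_ , c'≤r) , inj₁ refl) u∈ =
    nonNeighbours-few G (V c) _ (proj₂ (proj₂ (superRegular c c≥1 c'≤r)) _ u∈)
  superRegular⇒fewNonNeighbours G V r superRegular {c} {c'} ((_ , c≤r) , (c'≥1 , _) , inj₂ refl) u∈ =
    nonNeighbours-few G (V c) _ (proj₁ (proj₂ (superRegular c' c'≥1 c≤r)) _ u∈)

open import Defs
open import Data.Nat as ℕ using (ℕ; suc)
open import Data.Fin using (Fin; zero)
open import Data.Fin.Subset using (Subset; _∈_; ∣_∣)
open import Data.Product using (Σ; _×_; ∃)
open import Data.Rational using (ℚ; _≤_; _<_; _-_; _*_; _+_)
open import Relation.Binary.PropositionalEquality using (_≡_; _≢_)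
open import Relation.Nullary using (¬_)

open import Data.Product using (_,_)
open import Data.Rational using (_<?_)
open import Relation.Nullary.Decidable using (toWitness)
open Combinatorics using (module Greedy; LadderIn-map; Adj-sym; blockSize; blockSize-room; blockSize-long; ladder-long)
open Densities using (√ε; d; half-≤; superRegular⇒fewNonNeighbours)

lemma3p11 :
  Σ ℚ λ s → Σ ℚ λ d → Σ ℕ λ l₀ →
    (ι 0 < s) × (ι 10 * s < d) × (d < ι 1) ×
    (∀ {n} (G : Graph n) (r l : ℕ) (V : ℕ → Subset n) →
      2 ℕ.≤ r → l₀ ℕ.≤ l →
      (∀ i → 1 ℕ.≤ i → i ℕ.≤ r → ∣ V i ∣ ≡ l) →
      (∀ i j v → 1 ℕ.≤ i → i ℕ.≤ r → 1 ℕ.≤ j → j ℕ.≤ r → i ≢ j →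
         v ∈ V i → ¬ (v ∈ V j)) →
      (∀ i → 1 ℕ.≤ i → suc i ℕ.≤ r → SuperRegular G (s * s) d (V i) (V (suc i))) →
      (x₁ x₂ : Fin n) → x₁ ∈ V 1 → x₂ ∈ V 2 →
      Σ ℕ λ m → Σ (LadderIn G (λ v → (∃ λ i → 1 ℕ.≤ i × i ℕ.≤ r × v ∈ V i) × v ≢ x₁ × v ≢ x₂)
                            (suc m)) λ L →
        (a L zero ∈ V 2) × Adj G x₁ (a L zero) ×
        (b L zero ∈ V 1) × Adj G x₂ (b L zero) ×
        ((d - ι 5 * s) * ι (r ℕ.* l) ≤ d * ι (2 ℕ.* suc m)))
lemma3p11 =
    √ε , d , 50
  , toWitness {a? = ι 0 <? √ε} _ , toWitness {a? = ι 10 * √ε <? d} _ , toWitness {a? = d <? ι 1} _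
  , λ {n} G r l V 2≤r 50≤l sizes disjoint superRegular x₁ x₂ x₁∈ x₂∈ →
      let open Greedy G V r l
          j = blockSize l
          (L , x₂~b₀ , a₀~x₁) , a₀∈ , b₀∈ =
            Embedding.Blocks.ladder
              (λ (i₁ , i₂) (j₁ , j₂) i≢j → disjoint _ _ _ i₁ i₂ j₁ j₂ i≢j) (λ (c₁ , c₂) → sizes _ c₁ c₂)
              (superRegular⇒fewNonNeighbours G V r superRegular) j (blockSize-room 50≤l) 2≤r x₁∈ x₂∈
          m = j ℕ.+ suc j ℕ.+ (r ℕ.∸ 2) ℕ.* suc j
      in  m
        , LadderIn-map (λ (inClasses , v∉U₀) → let _ , v≢x₂ , v≢x₁ = ∉-withRung v∉U₀ in inClasses , v≢x₁ , v≢x₂) L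
        , a₀∈ , Adj-sym G a₀~x₁ , b₀∈ , x₂~b₀
        , half-≤ (r ℕ.* l) (2 ℕ.* suc m) (ladder-long j 2≤r (blockSize-long 50≤l))
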